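{- For all sufficiently large $r$, every $2$-intersecting $r$-uniform hypergraph $H$ with $\tau(H)=r-1$ satisfies $|E(H)|>5r$.
   Context: A hypergraph is $r$-uniform if every edge has exactly $r$ vertices, and $2$-intersecting if any two distinct edges share at least two vertices; for such hypergraphs $\tau(H)\le r-1$. The covering number $\tau(H)$ is the minimum size of a set of vertices meeting every edge. Hypergraphs are finite and simple. -}

module Defs where

open import Data.Nat using (ℕ; _≤_)
open import Data.Fin.Subset using (Subset; _∩_; ∣_∣; Nonempty)
open import Data.List using (List; length)
open import Data.List.Membership.Propositional using (_∈_)
open import Data.List.Relation.Unary.Unique.Propositional using (Unique)
open import Data.Product using (_×_)
open import Relation.Binary.PropositionalEquality using (_≡_; _≢_)

record Hypergraph (n : ℕ) : Set where
  field
    edges  : List (Subset n)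
    simple : Unique edges
open Hypergraph public

numEdges : ∀ {n} → Hypergraph n → ℕ
numEdges H = length (edges H)

Uniform : ∀ {n} → ℕ → Hypergraph n → Set
Uniform r H = ∀ {e} → e ∈ edges H → ∣ e ∣ ≡ r

TwoIntersecting : ∀ {n} → Hypergraph n → Set
TwoIntersecting H = ∀ {e f} → e ∈ edges H → f ∈ edges H → e ≢ f → 2 ≤ ∣ e ∩ f ∣

IsCover : ∀ {n} → Hypergraph n → Subset n → Set
IsCover H C = ∀ {e} → e ∈ edges H → Nonempty (C ∩ e)

CoveringNumberIs : ∀ {n} → Hypergraph n → ℕ → Set
CoveringNumberIs H k =
  (Data.Product.∃ λ C → IsCover H C × ∣ C ∣ ≡ k) × (∀ C → IsCover H C → k ≤ ∣ C ∣)

-- Fix an edge e, so |e| = r, and split it as e = X ⊎ Y with |X| = a, |Y| = b.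
-- For x ∈ X and y ∈ Y the set e ∖ {x, y} has r − 2 < τ(H) vertices, so some
-- edge f misses it; as |f ∩ e| ≥ 2 this forces f ∩ e = {x, y}.  Distinct pairs
-- therefore give distinct edges and |E(H)| ≥ a b.  With a = 6 and b = r − 6
-- this exceeds 5r as soon as r ≥ 37.
module Submission where

open import Defs
open import Data.Nat using (ℕ; _≤_; _<_; _*_; _∸_)
open import Data.Product using (∃)
open import Relation.Binary.PropositionalEquality using (_≡_)

open import Data.Bool using (true; false)
open import Data.Empty using (⊥-elim)
open import Data.Fin using (Fin; zero; suc; _↑ˡ_; _↑ʳ_; splitAt; remQuot)
open import Data.Fin.Properties
  using (suc-injective; _≟_; ↑ˡ-injective; ↑ʳ-injective; splitAt-↑ˡ; splitAt-↑ʳ; *↔×; injective⇒≤)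
open import Data.Fin.Subset using (Subset; ∣_∣; _∩_; _∈_; _-_; ⁅_⁆; ⊥; _⊆_; Empty)
open import Data.Fin.Subset.Properties
  using (nonempty?; x∈p∩q⁺; x∈p∩q⁻; x∈p∧x≢y⇒x∈p-y; x∈p⇒∣p-x∣<∣p∣; x∈⁅x⁆; ∣⁅x⁆∣≡1; ∣⊥∣≡0; p⊆q⇒∣p∣≤∣q∣; ∩-idem)
open import Data.List using (lookup)
import Data.List.Membership.Propositional as List
open import Data.List.Membership.Propositional.Properties using (∈-lookup)
open import Data.List.Relation.Unary.All using (all?)
import Data.List.Relation.Unary.All as All
open import Data.List.Relation.Unary.All.Properties using (¬All⇒Any¬)
open import Data.List.Relation.Unary.Any using (index)
open import Data.List.Relation.Unary.Any.Properties using (lookup-index)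
open import Data.Nat using (s≤s; _+_)
open import Data.Nat.Properties
  using (≤-trans; <-≤-trans; m≤m+n; m+n≤o⇒m≤o; ∸-monoˡ-≤; 1+n≰n; m+[n∸m]≡n)
open import Data.Nat.Tactic.RingSolver using (solve-∀)
open import Data.Product using (_×_; _,_; proj₁; proj₂)
open import Data.Sum using (_⊎_; inj₁; inj₂; swap)
open import Data.Vec using (_∷_; here; there)
open import Data.Vec.Properties using (≡-dec)
import Data.Bool.Properties as Bool
open import Function using (_∘_; Injective)
open import Function.Bundles using (Injection)
open import Function.Properties.Inverse using (↔⇒↣)
open import Relation.Nullary using (¬_; yes; no; contradiction)
open import Relation.Binary.PropositionalEquality using (refl; sym; trans; cong; cong₂; subst; _≢_)

element : ∀ {n} (p : Subset n) → Fin ∣ p ∣ → Fin n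
element (true  ∷ p) zero    = zero
element (true  ∷ p) (suc i) = suc (element p i)
element (false ∷ p) i       = suc (element p i)

element-∈ : ∀ {n} (p : Subset n) (i : Fin ∣ p ∣) → element p i ∈ p
element-∈ (true  ∷ p) zero    = here
element-∈ (true  ∷ p) (suc i) = there (element-∈ p i)
element-∈ (false ∷ p) i       = there (element-∈ p i)

element-injective : ∀ {n} (p : Subset n) → Injective _≡_ _≡_ (element p)
element-injective (true  ∷ p) {zero}  {zero}  _  = refl
element-injective (true  ∷ p) {suc i} {suc j} eq = cong suc (element-injective p (suc-injective eq))
element-injective (false ∷ p)                 eq = element-injective p (suc-injective eq)

∣p∣≡m⇒enumeration : ∀ {n m} (p : Subset n) → ∣ p ∣ ≡ m →
                    ∃ λ (v : Fin m → Fin n) → Injective _≡_ _≡_ v × (∀ i → v i ∈ p)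
∣p∣≡m⇒enumeration p refl = element p , element-injective p , element-∈ p

∣p-x-y∣+2≤∣p∣ : ∀ {n} {p : Subset n} {x y} → x ∈ p → y ∈ p → x ≢ y → 2 + ∣ p - x - y ∣ ≤ ∣ p ∣
∣p-x-y∣+2≤∣p∣ x∈p y∈p x≢y =
  <-≤-trans (s≤s (x∈p⇒∣p-x∣<∣p∣ (x∈p∧x≢y⇒x∈p-y y∈p (x≢y ∘ sym)))) (x∈p⇒∣p-x∣<∣p∣ x∈p)

p⊆⁅x⁆⇒∣p∣≤1 : ∀ {n} {p : Subset n} x → p ⊆ ⁅ x ⁆ → ∣ p ∣ ≤ 1
p⊆⁅x⁆⇒∣p∣≤1 x p⊆⁅x⁆ = subst (_ ≤_) (∣⁅x⁆∣≡1 x) (p⊆q⇒∣p∣≤∣q∣ p⊆⁅x⁆)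

infix 4 _⊆⁅_,_⁆
_⊆⁅_,_⁆ : ∀ {n} → Subset n → Fin n → Fin n → Set
p ⊆⁅ x , y ⁆ = ∀ {w} → w ∈ p → w ≡ x ⊎ w ≡ y

p-x-y∩q≡∅⇒q∩p⊆⁅x,y⁆ : ∀ {n} {p q : Subset n} {x y} → Empty ((p - x - y) ∩ q) → q ∩ p ⊆⁅ x , y ⁆
p-x-y∩q≡∅⇒q∩p⊆⁅x,y⁆ {p = p} {q} {x} {y} empty {w} w∈q∩p with x∈p∩q⁻ q p w∈q∩p | w ≟ x | w ≟ y
... | _         | yes w≡x | _       = inj₁ w≡x
... | _         | no _    | yes w≡y = inj₂ w≡y
... | w∈q , w∈p | no w≢x  | no w≢y  =
  ⊥-elim (empty (w , x∈p∩q⁺ (x∈p∧x≢y⇒x∈p-y (x∈p∧x≢y⇒x∈p-y w∈p w≢x) w≢y , w∈q)))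

-- If x ≢ x′, then x ≢ y′ leaves y as the only possible element of p.
⊆⁅x,y⁆-fst : ∀ {n} {p : Subset n} {x y x′ y′} → 2 ≤ ∣ p ∣ →
             p ⊆⁅ x , y ⁆ → p ⊆⁅ x′ , y′ ⁆ → x ≢ y′ → x ≡ x′
⊆⁅x,y⁆-fst {p = p} {x} {y} {x′} {y′} 2≤∣p∣ p⊆xy p⊆x′y′ x≢y′ with x ≟ x′
... | yes x≡x′ = x≡x′
... | no  x≢x′ = contradiction (≤-trans 2≤∣p∣ (p⊆⁅x⁆⇒∣p∣≤1 y p⊆⁅y⁆)) λ { (s≤s ()) }
  where
  p⊆⁅y⁆ : p ⊆ ⁅ y ⁆
  p⊆⁅y⁆ {w} w∈p with p⊆xy w∈p | p⊆x′y′ w∈p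
  ... | inj₂ refl | _         = x∈⁅x⁆ w
  ... | inj₁ refl | inj₁ w≡x′ = contradiction w≡x′ x≢x′
  ... | inj₁ refl | inj₂ w≡y′ = contradiction w≡y′ x≢y′

⊆⁅x,y⁆-unique : ∀ {n} {p : Subset n} {x y x′ y′} → 2 ≤ ∣ p ∣ →
                p ⊆⁅ x , y ⁆ → p ⊆⁅ x′ , y′ ⁆ → x ≢ y′ → x′ ≢ y → x ≡ x′ × y ≡ y′
⊆⁅x,y⁆-unique 2≤∣p∣ p⊆xy p⊆x′y′ x≢y′ x′≢y =
  ⊆⁅x,y⁆-fst 2≤∣p∣ p⊆xy p⊆x′y′ x≢y′ ,
  ⊆⁅x,y⁆-fst 2≤∣p∣ (swap ∘ p⊆xy) (swap ∘ p⊆x′y′) (x′≢y ∘ sym)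

↑ˡ≢↑ʳ : ∀ {a b} (i : Fin a) (j : Fin b) → i ↑ˡ b ≢ a ↑ʳ j
↑ˡ≢↑ʳ {a} {b} i j eq
  with () ← trans (sym (splitAt-↑ˡ a i b)) (trans (cong (splitAt a) eq) (splitAt-↑ʳ a b j))

uncoveredEdge : ∀ {n} (H : Hypergraph n) {C} → ¬ IsCover H C →
                ∃ λ i → Empty (C ∩ lookup (edges H) i)
uncoveredEdge H {C} ¬cover with all? (λ f → nonempty? (C ∩ f)) (edges H)
... | yes covered = contradiction (λ {f} → All.lookup covered {f}) ¬cover
... | no ¬covered = index missed , lookup-index missed
  where missed = ¬All⇒Any¬ (λ f → nonempty? (C ∩ f)) (edges H) ¬covered

⊥-not-cover : ∀ {n} {H : Hypergraph n} {k} → 1 ≤ k →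
              (∀ C → IsCover H C → k ≤ ∣ C ∣) → ¬ IsCover H ⊥
⊥-not-cover {n} 1≤k τ≥ cover with () ← ≤-trans 1≤k (subst (_ ≤_) (∣⊥∣≡0 n) (τ≥ ⊥ cover))

2≤∣f∩e∣ : ∀ {n} {H : Hypergraph n} {e f} → TwoIntersecting H → 2 ≤ ∣ e ∣ →
          f List.∈ edges H → e List.∈ edges H → 2 ≤ ∣ f ∩ e ∣
2≤∣f∩e∣ {e = e} {f} two 2≤∣e∣ f∈H e∈H with ≡-dec Bool._≟_ f e
... | no  f≢e  = two f∈H e∈H f≢e
... | yes refl = subst (2 ≤_) (sym (cong ∣_∣ (∩-idem f))) 2≤∣e∣

module _ {n} (H : Hypergraph n) {r} (two : TwoIntersecting H)
         (τ≥ : ∀ C → IsCover H C → r ∸ 1 ≤ ∣ C ∣)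
         {e} (e∈H : e List.∈ edges H) (∣e∣≡r : ∣ e ∣ ≡ r) where

  ∃edge∩e⊆⁅x,y⁆ : ∀ {x y} → x ∈ e → y ∈ e → x ≢ y →
                    ∃ λ i → lookup (edges H) i ∩ e ⊆⁅ x , y ⁆
  ∃edge∩e⊆⁅x,y⁆ {x} {y} x∈e y∈e x≢y =
    let i , empty = uncoveredEdge H not-cover in i , p-x-y∩q≡∅⇒q∩p⊆⁅x,y⁆ empty
    where
    2+∣e-x-y∣≤r : 2 + ∣ e - x - y ∣ ≤ r
    2+∣e-x-y∣≤r = subst (_ ≤_) ∣e∣≡r (∣p-x-y∣+2≤∣p∣ x∈e y∈e x≢y)
    not-cover : ¬ IsCover H (e - x - y)
    not-cover cover = 1+n≰n (≤-trans (∸-monoˡ-≤ 1 2+∣e-x-y∣≤r) (τ≥ _ cover))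

  module _ {a b} (v : Fin (a + b) → Fin n) (v-injective : Injective _≡_ _≡_ v)
           (v∈e : ∀ i → v i ∈ e) where

    x : Fin a → Fin n
    x i = v (i ↑ˡ b)

    y : Fin b → Fin n
    y j = v (a ↑ʳ j)

    x≢y : ∀ i j → x i ≢ y j
    x≢y i j = ↑ˡ≢↑ʳ i j ∘ v-injective

    edgeOf : Fin a × Fin b → Fin (numEdges H)
    edgeOf (i , j) = proj₁ (∃edge∩e⊆⁅x,y⁆ (v∈e _) (v∈e _) (x≢y i j))

    edgeOf-∩e : ∀ ij → lookup (edges H) (edgeOf ij) ∩ e ⊆⁅ x (proj₁ ij) , y (proj₂ ij) ⁆
    edgeOf-∩e (i , j) = proj₂ (∃edge∩e⊆⁅x,y⁆ (v∈e _) (v∈e _) (x≢y i j))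

    edgeOf-injective : Injective _≡_ _≡_ edgeOf
    edgeOf-injective {i , j} {i′ , j′} same =
      cong₂ _,_ (↑ˡ-injective b i i′ (v-injective (proj₁ same-pair)))
                (↑ʳ-injective a j j′ (v-injective (proj₂ same-pair)))
      where
      2≤∣e∣ : 2 ≤ ∣ e ∣
      2≤∣e∣ = m+n≤o⇒m≤o 2 (∣p-x-y∣+2≤∣p∣ (v∈e (i ↑ˡ b)) (v∈e (a ↑ʳ j)) (x≢y i j))
      2≤∣edge∩e∣ : 2 ≤ ∣ lookup (edges H) (edgeOf (i , j)) ∩ e ∣
      2≤∣edge∩e∣ = 2≤∣f∩e∣ {H = H} two 2≤∣e∣ (∈-lookup {xs = edges H} _) e∈H
      same-pair : x i ≡ x i′ × y j ≡ y j′
      same-pair = ⊆⁅x,y⁆-unique 2≤∣edge∩e∣ (edgeOf-∩e (i , j))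
                    (subst (λ k → lookup (edges H) k ∩ e ⊆⁅ x i′ , y j′ ⁆) (sym same)
                           (edgeOf-∩e (i′ , j′)))
                    (x≢y i j′) (x≢y i′ j)

  split≤numEdges : ∀ a b → a + b ≡ r → a * b ≤ numEdges H
  split≤numEdges a b a+b≡r
    with v , v-injective , v∈e ← ∣p∣≡m⇒enumeration e (trans ∣e∣≡r (sym a+b≡r))
    = injective⇒≤ {f = edgeOf v v-injective v∈e ∘ remQuot b}
                  (Injection.injective (↔⇒↣ *↔×) ∘ edgeOf-injective v v-injective v∈e)

5r<6[r∸6] : ∀ r → 37 ≤ r → 5 * r < 6 * (r ∸ 6)
5r<6[r∸6] r 37≤r =
  subst (λ r → 5 * r < 6 * (r ∸ 6)) (m+[n∸m]≡n 37≤r) (5[37+k]<6[31+k] (r ∸ 37))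
  where
  5[37+k]<6[31+k] : ∀ k → 5 * (37 + k) < 6 * (31 + k)
  5[37+k]<6[31+k] k = subst (5 * (37 + k) <_) (expand k) (m≤m+n (1 + 5 * (37 + k)) k)
    where
    expand : ∀ k → 1 + 5 * (37 + k) + k ≡ 6 * (31 + k)
    expand = solve-∀

mainTheorem12 : ∃ λ r₀ → ∀ r → r₀ ≤ r → ∀ n (H : Hypergraph n) →
                  Uniform r H → TwoIntersecting H → CoveringNumberIs H (r ∸ 1) →
                  5 * r < numEdges H
mainTheorem12 = 37 , λ r 37≤r n H unif two (_ , τ≥) →
  let i , _ = uncoveredEdge H (⊥-not-cover {H = H} (∸-monoˡ-≤ 1 (≤-trans (m≤m+n 2 35) 37≤r)) τ≥)
      e∈H   = ∈-lookup {xs = edges H} i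
  in <-≤-trans (5r<6[r∸6] r 37≤r)
               (split≤numEdges H two τ≥ e∈H (unif e∈H) 6 (r ∸ 6)
                               (m+[n∸m]≡n (≤-trans (m≤m+n 6 31) 37≤r)))
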